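{- Let $X$ be a countable set. If $n\in\omega$ and $\mathcal{F}\in\mathfrak{F}_n$ (a filter on $X$), then ${\rm rk}(\mathcal{F})\leq n$.
   Context: Filters on $X$ are viewed as subsets of the Cantor space $2^X$. For $\mathcal{A}\subset\mathcal{P}(X)$ let $\mathcal{A}^*=\{A\subset X:X\setminus A\in\mathcal{A}\}$. The rank of a filter is ${\rm rk}(\mathcal{F})=\min\{\alpha<\omega_1:$ there is a $\Sigma^0_{1+\alpha}$ set $S$ with $\mathcal{F}\subset S$ and $S\cap\mathcal{F}^*=\emptyset\}$. The Fréchet filter $\mathcal{F}_{Fr}$ on $\omega$ consists of cofinite subsets of $\omega$. For a filter $\mathcal{F}$ on $I$ and filters $\mathcal{F}_i$ on $X$, $\lim_{\mathcal{F}}\mathcal{F}_i=\{A\subset X:\{i\in I:A\in\mathcal{F}_i\}\in\mathcal{F}\}$. The families $\mathfrak{F}_\alpha$ are defined inductively: $\mathfrak{F}_0$ is the family of all principal ultrafilters $\{A\subset X:x\in A\}$, $x\in X$; for $\alpha>0$, $\mathfrak{F}_\alpha$ is the family of all filters on $X$ equal to $\lim_{\mathcal{F}_{Fr}}\mathcal{F}_i$ for some sequence $(\mathcal{F}_i)_{i\in\omega}$ with $\mathcal{F}_i\in\bigcup_{\xi<\alpha}\mathfrak{F}_\xi$ for every $i$. -}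

module Defs where

open import Data.Nat using (ℕ; zero; suc; _≤_; _<_)
open import Data.Bool using (Bool; true; false; not)
open import Data.Maybe using (Maybe; just; nothing)
open import Data.List using (List)
open import Data.List.Relation.Unary.All using (All)
open import Data.Product using (Σ; ∃; ∃-syntax; _×_; _,_)
open import Data.Empty using (⊥)
open import Function.Bundles using (_⇔_)
open import Function.Definitions using (Injective)
open import Relation.Binary.PropositionalEquality using (_≡_)

Countable : Set → Set
Countable X = Σ (X → ℕ) (λ f → Injective _≡_ _≡_ f)

-- Points of the Cantor space 2^X are subsets A ⊆ X (A x ≡ true means x ∈ A).
-- Subsets of 2^X (e.g. filters) are Set-valued predicates on 2^X.
Sub : Set → Set₁
Sub X = (X → Bool) → Set

module _ (X : Set) where

  dual : Sub X → Sub X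
  dual 𝒜 A = 𝒜 (λ x → not (A x))

  -- basic clopen set of 2^X given by a finite partial assignment
  Basic : List (X × Bool) → Sub X
  Basic l A = All (λ p → A (Data.Product.proj₁ p) ≡ Data.Product.proj₂ p) l

  -- Codes for the finite-level Borel classes: SigmaCode k codes a Σ⁰_{1+k} set.
  --  * Σ⁰_1 (open) sets: countable unions of basic clopen sets (`nothing` = empty piece).
  --  * Σ⁰_{1+(m+1)} sets: countable unions of Π⁰_{1+j} sets, j ≤ m,
  --    where Π⁰_{1+j} sets are complements of Σ⁰_{1+j} sets.
  data SigmaCode : ℕ → Set where
    open-set : (ℕ → Maybe (List (X × Bool))) → SigmaCode zero
    union-Π  : ∀ {m} → (lvl : ℕ → ℕ) → (∀ i → lvl i ≤ m) →
               (∀ i → SigmaCode (lvl i)) → SigmaCode (suc m)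

  ⟦_⟧ : ∀ {k} → SigmaCode k → Sub X
  ⟦ open-set U ⟧ A = ∃[ i ] ∃[ l ] (U i ≡ just l × Basic l A)
  ⟦ union-Π lvl _ c ⟧ A = ∃[ i ] (⟦ c i ⟧ A → ⊥)

  Separates : Sub X → Sub X → Set
  Separates S ℱ = (∀ A → ℱ A → S A) × (∀ A → S A → dual ℱ A → ⊥)

  -- rk(ℱ) ≤ n : the minimal α with a Σ⁰_{1+α} separator is ≤ n,
  -- i.e. there is α ≤ n and a Σ⁰_{1+α} set S with ℱ ⊆ S, S ∩ ℱ* = ∅.
  RankLE : Sub X → ℕ → Set
  RankLE ℱ n = ∃[ α ] (α ≤ n × Σ (SigmaCode α) (λ c → Separates ⟦ c ⟧ ℱ))

  Frechet : (ℕ → Set) → Set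
  Frechet P = ∃[ N ] (∀ i → N ≤ i → P i)

  limFr : (ℕ → Sub X) → Sub X
  limFr ℱs A = Frechet (λ i → ℱs i A)

  principal : X → Sub X
  principal x A = A x ≡ true

  -- Frak n ℱ :  ℱ ∈ 𝔉_n  (filters equal as sets of subsets, i.e. extensionally)
  data Frak : ℕ → Sub X → Set₁ where
    frak-principal : ∀ {ℱ} (x : X) → (∀ A → ℱ A ⇔ principal x A) → Frak zero ℱ
    frak-limit : ∀ {m ℱ} (ℱs : ℕ → Sub X) (ξ : ℕ → ℕ) →
                 (∀ i → ξ i < suc m) → (∀ i → Frak (ξ i) (ℱs i)) →
                 (∀ A → ℱ A ⇔ limFr ℱs A) → Frak (suc m) ℱ

module Submission where

-- We prove a two-sided version of the rank bound by induction on
-- the construction of ℱ ∈ 𝔉_n: for every level j ≥ n there are Σ⁰_{1+j} sets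
-- P and Q with ℱ ⊆ P, P ∩ ℱ* = ∅ and ℱ* ⊆ Q, Q ∩ ℱ = ∅.
--  * A principal ultrafilter at x is separated by {A : x ∈ A} and its dual by
--    {A : x ∉ A}; these sets are clopen, hence Σ⁰_{1+j} at every level j.
--  * For ℱ = lim_Fr ℱᵢ with separators (Pᵢ, Qᵢ) at level j, the set
--    ⋃_N ⋂_{k} (2^X ∖ Q_{N+k}) (the points lying eventually outside the Qᵢ) is
--    Σ⁰_{1+(j+1)} and separates ℱ; symmetrically with the Pᵢ for ℱ*.
-- The only technical ingredient is that a countable union of Σ⁰_{1+j} sets is
-- again Σ⁰_{1+j}, which needs a surjection ℕ → ℕ × ℕ to flatten a double union.

open import Defs
open import Data.Nat using (ℕ; zero; suc; _+_; _≤_; s≤s)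
open import Data.Nat.Properties using (≤-refl; ≤-trans; ≤-pred; +-suc; +-identityʳ; m≤m+n; m≤n+m)
open import Data.Bool using (Bool; true; false; not)
open import Data.Bool.Properties using (not-¬; ¬-not; not-involutive)
open import Data.Maybe using (Maybe; just)
open import Data.List using (List; []; _∷_)
open import Data.List.Relation.Unary.All using ([]; _∷_)
open import Data.Product using (Σ; ∃-syntax; _×_; _,_; proj₁; proj₂)
open import Data.Empty using (⊥)
open import Function.Bundles using (_⇔_; mk⇔; Equivalence)
open import Relation.Binary.PropositionalEquality using (_≡_; refl; sym; trans; cong; subst)

-- A surjection ℕ → ℕ × ℕ, enumerating the pairs diagonal by diagonal:
-- (0,0), (0,1), (1,0), (0,2), (1,1), (2,0), …

next : ℕ × ℕ → ℕ × ℕ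
next (a , zero)  = (zero , suc a)
next (a , suc b) = (suc a , b)

unpair : ℕ → ℕ × ℕ
unpair zero    = (zero , zero)
unpair (suc n) = next (unpair n)

unpair-along-diagonal : ∀ a b n → unpair n ≡ (zero , a + b) → unpair (n + a) ≡ (a , b)
unpair-along-diagonal zero b n e rewrite +-identityʳ n = e
unpair-along-diagonal (suc a) b n e rewrite +-suc n a =
  cong next (unpair-along-diagonal a (suc b) n (trans e (cong (zero ,_) (sym (+-suc a b)))))

unpair-hits-diagonal : ∀ s → ∃[ n ] unpair n ≡ (zero , s)
unpair-hits-diagonal zero = zero , refl
unpair-hits-diagonal (suc s) with unpair-hits-diagonal s
... | n , e = suc (n + s) ,
  cong next (unpair-along-diagonal s zero n (trans e (cong (zero ,_) (sym (+-identityʳ s)))))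

unpair-surjective : ∀ a b → ∃[ n ] unpair n ≡ (a , b)
unpair-surjective a b with unpair-hits-diagonal (a + b)
... | n , e = n + a , unpair-along-diagonal a b n e


module _ (X : Set) where

  Code : ℕ → Set
  Code = SigmaCode X

  sem : ∀ {j} → Code j → Sub X
  sem = ⟦_⟧ X

  complement : (X → Bool) → (X → Bool)
  complement A x = not (A x)

  -- A code of level j is a countable union of "terms": basic clopen pieces at
  -- level 0, complements of lower-level codes at level j + 1.
  Term : ℕ → Set
  Term zero    = Maybe (List (X × Bool))
  Term (suc m) = Σ ℕ λ l → l ≤ m × Code l

  termSem : ∀ {j} → Term j → Sub X
  termSem {zero}  t A = ∃[ l ] (t ≡ just l × Basic X l A)
  termSem {suc m} t A = sem (proj₂ (proj₂ t)) A → ⊥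

  terms : ∀ {j} → Code j → ℕ → Term j
  terms (open-set U)          i = U i
  terms (union-Π lvl lvl≤ c) i = lvl i , lvl≤ i , c i

  fromTerms : ∀ {j} → (ℕ → Term j) → Code j
  fromTerms {zero}  t = open-set t
  fromTerms {suc m} t = union-Π (λ i → proj₁ (t i)) (λ i → proj₁ (proj₂ (t i))) (λ i → proj₂ (proj₂ (t i)))

  sem-terms : ∀ {j} (c : Code j) A → sem c A ⇔ (∃[ i ] termSem (terms c i) A)
  sem-terms (open-set U)      A = mk⇔ (λ s → s) (λ s → s)
  sem-terms (union-Π _ _ _) A = mk⇔ (λ s → s) (λ s → s)

  ⋃ : ∀ {j} → (ℕ → Code j) → Code j
  ⋃ f = fromTerms (λ n → terms (f (proj₁ (unpair n))) (proj₂ (unpair n)))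

  ⋃-sem : ∀ {j} (f : ℕ → Code j) A → sem (⋃ f) A ⇔ (∃[ k ] sem (f k) A)
  ⋃-sem f A = mk⇔ to from
    where
    fromTerms-sem : ∀ {j} (t : ℕ → Term j) → sem (fromTerms t) A → ∃[ i ] termSem (t i) A
    fromTerms-sem {zero}  t s = s
    fromTerms-sem {suc m} t s = s

    toTerms-sem : ∀ {j} (t : ℕ → Term j) → ∃[ i ] termSem (t i) A → sem (fromTerms t) A
    toTerms-sem {zero}  t s = s
    toTerms-sem {suc m} t s = s

    to : sem (⋃ f) A → ∃[ k ] sem (f k) A
    to s with fromTerms-sem _ s
    ... | n , t = proj₁ (unpair n) , Equivalence.from (sem-terms (f _) A) (_ , t)

    from : ∃[ k ] sem (f k) A → sem (⋃ f) A
    from (k , s) with Equivalence.to (sem-terms (f k) A) s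
    ... | i , t with unpair-surjective k i
    ... | n , e = toTerms-sem _ (n , subst (λ p → termSem (terms (f (proj₁ p)) (proj₂ p)) A) (sym e) t)

  -- The clopen set {A : A x ≡ b}, coded at an arbitrary level j: at level
  -- j + 1 it is the complement of the level-j code of {A : A x ≡ not b}.
  point : X → Bool → (j : ℕ) → Code j
  point x b zero    = open-set (λ _ → just ((x , b) ∷ []))
  point x b (suc j) = union-Π (λ _ → j) (λ _ → ≤-refl) (λ _ → point x (not b) j)

  point-sem : ∀ x b j A → sem (point x b j) A ⇔ (A x ≡ b)
  point-sem x b zero A = mk⇔ (λ { (_ , _ , refl , (p ∷ [])) → p }) (λ p → zero , _ , refl , (p ∷ []))
  point-sem x b (suc j) A = mk⇔
    (λ { (_ , h) → trans (¬-not (λ q → h (Equivalence.from (point-sem x (not b) j A) q))) (not-involutive b) })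
    (λ p → zero , λ q → not-¬ p (Equivalence.to (point-sem x (not b) j A) q))

  eventuallyOutside : ∀ {j} → (ℕ → Code j) → Code (suc j)
  eventuallyOutside {j} Q = union-Π (λ _ → j) (λ _ → ≤-refl) (λ N → ⋃ (λ k → Q (N + k)))

  eventuallyOutside-covers : ∀ {j} (𝒢 : ℕ → Sub X) (Q : ℕ → Code j) →
    (∀ i A → 𝒢 i A → sem (Q i) A → ⊥) → ∀ A → limFr X 𝒢 A → sem (eventuallyOutside Q) A
  eventuallyOutside-covers 𝒢 Q disjoint A (N , eventually) = N , λ s →
    let (k , inQ) = Equivalence.to (⋃-sem (λ k → Q (N + k)) A) s
    in disjoint (N + k) A (eventually (N + k) (m≤m+n N k)) inQ

  eventuallyOutside-avoids : ∀ {j} (ℋ : ℕ → Sub X) (Q : ℕ → Code j) →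
    (∀ i A → ℋ i A → sem (Q i) A) → ∀ A → sem (eventuallyOutside Q) A → limFr X ℋ A → ⊥
  eventuallyOutside-avoids ℋ Q covers A (N , outside) (M , eventually) =
    outside (Equivalence.from (⋃-sem (λ k → Q (N + k)) A) (M , covers (N + M) A (eventually (N + M) (m≤n+m M N))))

  record TwoSidedSep (ℱ : Sub X) (j : ℕ) : Set where
    field
      P : Code j
      Q : Code j
      P-covers   : ∀ A → ℱ A → sem P A
      P-avoids   : ∀ A → sem P A → dual X ℱ A → ⊥
      Q-covers   : ∀ A → dual X ℱ A → sem Q A
      Q-avoids   : ∀ A → sem Q A → ℱ A → ⊥

  open TwoSidedSep

  principal-sep : ∀ {ℱ} x → (∀ A → ℱ A ⇔ principal X x A) → ∀ j → TwoSidedSep ℱ j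
  principal-sep {ℱ} x ℱ≡ j = record
    { P = point x true j
    ; Q = point x false j
    ; P-covers = λ A f → from (point-sem x true j A) (to (ℱ≡ A) f)
    ; P-avoids = λ A s f* → not-¬ (to (point-sem x true j A) s) (not-true (in-dual A f*))
    ; Q-covers = λ A f* → from (point-sem x false j A) (not-true (in-dual A f*))
    ; Q-avoids = λ A s f → not-¬ (to (ℱ≡ A) f) (to (point-sem x false j A) s)
    }
    where
    open Equivalence
    in-dual : ∀ A → dual X ℱ A → not (A x) ≡ true
    in-dual A f* = to (ℱ≡ (complement A)) f*
    not-true : ∀ {u} → not u ≡ true → u ≡ false
    not-true {u} p = trans (sym (not-involutive u)) (cong not p)

  limit-sep : ∀ {ℱ j} (ℱs : ℕ → Sub X) → (∀ A → ℱ A ⇔ limFr X ℱs A) →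
    (∀ i → TwoSidedSep (ℱs i) j) → TwoSidedSep ℱ (suc j)
  limit-sep {ℱ} ℱs ℱ≡ sep = record
    { P = eventuallyOutside (λ i → Q (sep i))
    ; Q = eventuallyOutside (λ i → P (sep i))
    ; P-covers = λ A f → eventuallyOutside-covers ℱs _ (λ i → Q-avoids' i) A (to (ℱ≡ A) f)
    ; P-avoids = λ A s f* → eventuallyOutside-avoids ℱs* _ (λ i → Q-covers (sep i)) A s (to (ℱ≡ (complement A)) f*)
    ; Q-covers = λ A f* → eventuallyOutside-covers ℱs* _ (λ i → P-avoids' i) A (to (ℱ≡ (complement A)) f*)
    ; Q-avoids = λ A s f → eventuallyOutside-avoids ℱs _ (λ i → P-covers (sep i)) A s (to (ℱ≡ A) f)
    }
    where
    open Equivalence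
    ℱs* : ℕ → Sub X
    ℱs* i = dual X (ℱs i)
    Q-avoids' : ∀ i A → ℱs i A → sem (Q (sep i)) A → ⊥
    Q-avoids' i A f s = Q-avoids (sep i) A s f
    P-avoids' : ∀ i A → ℱs* i A → sem (P (sep i)) A → ⊥
    P-avoids' i A f* s = P-avoids (sep i) A s f*

  frak-sep : ∀ {n ℱ} → Frak X n ℱ → ∀ j → n ≤ j → TwoSidedSep ℱ j
  frak-sep (frak-principal x ℱ≡) j _ = principal-sep x ℱ≡ j
  frak-sep (frak-limit ℱs ξ ξ≤m frak ℱ≡) (suc j) (s≤s m≤j) =
    limit-sep ℱs ℱ≡ (λ i → frak-sep (frak i) j (≤-trans (≤-pred (ξ≤m i)) m≤j))


corollary3p7 : (X : Set) → Countable X → (n : ℕ) → (ℱ : Sub X) →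
    Frak X n ℱ → RankLE X ℱ n
corollary3p7 X _ n ℱ ℱ∈𝔉n = n , ≤-refl , P sep , P-covers sep , P-avoids sep
  where
  open TwoSidedSep
  sep : TwoSidedSep X ℱ n
  sep = frak-sep X ℱ∈𝔉n n ≤-refl
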